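{- Let $t\ge 1$ and $c\in \mathbb{Z}$. The following relation holds \begin{equation*} \begin{bmatrix} K;c+2 \\ t\end{bmatrix}=(q^t+q^{ -t})\begin{bmatrix} K;c+1 \\ t\end{bmatrix}-\begin{bmatrix} K;c \\ t\end{bmatrix}+\begin{bmatrix} K;c \\ t-2\end{bmatrix}. \end{equation*}
   Context: In $\mathbb{Q}(q)[K,K^{ -1}]$ (the Cartan part of the quantum group $\mathcal{U}_q(\mathfrak{sl}_2)$), for $a\in\mathbb{Z}$ let $[K;a]=\frac{q^aK-q^{ -a}K^{ -1}}{q-q^{ -1}}$, let $\{n\}_q=\frac{q^n-q^{ -n}}{q-q^{ -1}}$ and $\{n\}_q!=\{n\}_q\cdots\{1\}_q$, and for $c\in\mathbb{Z}$, $t\in\mathbb{N}_0$ let $\begin{bmatrix} K;c \\ t\end{bmatrix}=\frac{[K;c][K;c-1]\cdots[K;c-t+1]}{\{t\}_q!}$, equal to $1$ for $t=0$. By convention $\begin{bmatrix} K;c \\ t\end{bmatrix}=0$ if $t<0$. -}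

module Defs where

open import Level using (Level)
open import Algebra.Bundles using (CommutativeRing)
open import Data.Nat using (ℕ; zero; suc)
open import Data.Integer as ℤ using (ℤ; +_; -[1+_])

-- Quantum-group Cartan notation, interpreted in an arbitrary commutative
-- ring R containing elements
--   q, qi   (qi plays q⁻¹),
--   K, Ki   (Ki plays K⁻¹),
--   δ       (plays (q - q⁻¹)⁻¹),
--   ι n     (plays ({n}_q !)⁻¹).
-- The invertibility hypotheses are assumed in the statement; they make
-- these inverses unique, so all notions below are the paper's ones.
module QCartan {c ℓ : Level} (R : CommutativeRing c ℓ)
  (q qi K Ki δ : CommutativeRing.Carrier R) (ι : ℕ → CommutativeRing.Carrier R) where

  open CommutativeRing R

  pow : Carrier → ℕ → Carrier
  pow x zero    = 1#
  pow x (suc n) = x * pow x n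

  qpow : ℤ → Carrier
  qpow (+ n)      = pow q n
  qpow -[1+ n ]   = pow qi (suc n)

  Kbr : ℤ → Carrier
  Kbr a = (qpow a * K + - (qpow (ℤ.- a) * Ki)) * δ

  qnum : ℕ → Carrier
  qnum n = (pow q n + - pow qi n) * δ

  qfact : ℕ → Carrier
  qfact zero    = 1#
  qfact (suc n) = qnum (suc n) * qfact n

  falling : ℤ → ℕ → Carrier
  falling a zero    = 1#
  falling a (suc t) = falling a t * Kbr (a ℤ.- + t)

  binom : ℤ → ℕ → Carrier
  binom a t = falling a t * ι t

  binomℤ : ℤ → ℤ → Carrier
  binomℤ a (+ t)     = binom a t
  binomℤ a -[1+ t ]  = 0#

-- Put x = q^c K and y = q^{-c} K⁻¹. Then [K; c - i] = (q^{-i} x - q^i y)/(q - q⁻¹), and raising c by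
-- one replaces (x, y) by (q x, q⁻¹ y). For the product F(x, y, t) = [K;c][K;c-1]⋯[K;c-t+1] this gives
-- two q-Pascal rules,
--   F(q x, q⁻¹ y, t + 1) = q^{t+1} F(x, y, t + 1) + {t+1} q^t y F(x, y, t)
--                        = q^{-t-1} F(x, y, t + 1) + {t+1} q^{-t} x F(x, y, t).
-- Applying the first rule at (q x, q⁻¹ y) and at (x, y), and then the second one, shows that the
-- second difference F(q²x, q⁻²y, t) - (q^t + q^{-t}) F(q x, q⁻¹ y, t) + F(x, y, t) equals
-- {t}{t-1} x y F(x, y, t - 2). Since x y = 1, dividing by {t}! gives the claim.
module Submission where

open import Algebra.Bundles using (CommutativeRing)
open import Algebra.Solver.Ring.AlmostCommutativeRing
  using (_-Raw-AlmostCommutative⟶_; fromCommutativeRing)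
open import Data.Maybe using (Maybe; just; nothing)
open import Data.Nat as ℕ using (ℕ; zero; suc; _≤_)
import Data.Nat.Properties as ℕ
open import Data.Integer as ℤ using (ℤ; +_; -[1+_]; _⊖_; _◃_)
import Data.Integer.Properties as ℤ
open import Data.Sign as Sign using (Sign)
open import Relation.Binary.PropositionalEquality as ≡ using (_≡_)
open import Relation.Nullary using (yes; no)
open import Defs

-- Algebra.Solver.Ring needs a coefficient ring with decidable equality mapped homomorphically into
-- the ring; ℤ maps into every commutative ring.
module IntegerCoefficientSolver {a ℓ} (R : CommutativeRing a ℓ) where
  open CommutativeRing R
  open import Algebra.Properties.Ring ring
    using (-0#≈0#; -‿involutive; -‿distribˡ-*; -‿distribʳ-*; -‿+-comm; xyx⁻¹≈y)
  open import Algebra.Properties.Semiring.Mult.TCOptimised semiring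
    using (_×_; 1+×; ×-homo-+; ×1-homo-*)
  open import Relation.Binary.Reasoning.Setoid setoid

  signed : Sign → Carrier → Carrier
  signed Sign.+ x = x
  signed Sign.- x = - x

  fromℤ : ℤ → Carrier
  fromℤ i = signed (ℤ.sign i) (ℤ.∣ i ∣ × 1#)

  signed-cong : ∀ s {x y} → x ≈ y → signed s x ≈ signed s y
  signed-cong Sign.+ x≈y = x≈y
  signed-cong Sign.- x≈y = -‿cong x≈y

  signed-* : ∀ s t x y → signed (s Sign.* t) (x * y) ≈ signed s x * signed t y
  signed-* Sign.+ Sign.+ x y = refl
  signed-* Sign.+ Sign.- x y = -‿distribʳ-* x y
  signed-* Sign.- Sign.+ x y = -‿distribˡ-* x y
  signed-* Sign.- Sign.- x y = begin
    x * y         ≈⟨ -‿involutive (x * y) ⟨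
    - - (x * y)   ≈⟨ -‿cong (-‿distribʳ-* x y) ⟩
    - (x * - y)   ≈⟨ -‿distribˡ-* x (- y) ⟩
    - x * - y     ∎

  ◃-homo : ∀ s n → fromℤ (s ◃ n) ≈ signed s (n × 1#)
  ◃-homo Sign.+ zero    = refl
  ◃-homo Sign.- zero    = sym -0#≈0#
  ◃-homo Sign.+ (suc n) = refl
  ◃-homo Sign.- (suc n) = refl

  ⊖-homo : ∀ m n → fromℤ (m ⊖ n) ≈ m × 1# - n × 1#
  ⊖-homo zero    zero    = sym (trans (+-identityˡ _) -0#≈0#)
  ⊖-homo (suc m) zero    = sym (trans (+-congˡ -0#≈0#) (+-identityʳ _))
  ⊖-homo zero    (suc n) = sym (+-identityˡ _)
  ⊖-homo (suc m) (suc n) = begin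
    fromℤ (suc m ⊖ suc n)               ≡⟨ ≡.cong fromℤ (ℤ.[1+m]⊖[1+n]≡m⊖n m n) ⟩
    fromℤ (m ⊖ n)                       ≈⟨ ⊖-homo m n ⟩
    m × 1# - n × 1#                     ≈⟨ +-congʳ (xyx⁻¹≈y 1# (m × 1#)) ⟨
    1# + m × 1# - 1# - n × 1#           ≈⟨ +-assoc _ _ _ ⟩
    1# + m × 1# + (- 1# - n × 1#)       ≈⟨ +-congˡ (-‿+-comm 1# (n × 1#)) ⟩
    1# + m × 1# - (1# + n × 1#)         ≈⟨ +-cong (1+× m 1#) (-‿cong (1+× n 1#)) ⟨
    suc m × 1# - suc n × 1#             ∎

  +-homo : ∀ i j → fromℤ (i ℤ.+ j) ≈ fromℤ i + fromℤ j
  +-homo (+ m)    (+ n)    = ×-homo-+ 1# m n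
  +-homo (+ m)    -[1+ n ] = ⊖-homo m (suc n)
  +-homo -[1+ m ] (+ n)    = trans (⊖-homo n (suc m)) (+-comm _ _)
  +-homo -[1+ m ] -[1+ n ] = begin
    - (suc (suc (m ℕ.+ n)) × 1#)        ≡⟨ ≡.cong (λ k → - (suc k × 1#)) (ℕ.+-suc m n) ⟨
    - ((suc m ℕ.+ suc n) × 1#)          ≈⟨ -‿cong (×-homo-+ 1# (suc m) (suc n)) ⟩
    - (suc m × 1# + suc n × 1#)         ≈⟨ -‿+-comm _ _ ⟨
    - (suc m × 1#) - suc n × 1#         ∎

  *-homo : ∀ i j → fromℤ (i ℤ.* j) ≈ fromℤ i * fromℤ j
  *-homo i j = begin
    fromℤ (s ◃ m ℕ.* n)              ≈⟨ ◃-homo s (m ℕ.* n) ⟩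
    signed s ((m ℕ.* n) × 1#)        ≈⟨ signed-cong s (×1-homo-* m n) ⟩
    signed s ((m × 1#) * (n × 1#))   ≈⟨ signed-* (ℤ.sign i) (ℤ.sign j) _ _ ⟩
    fromℤ i * fromℤ j                ∎
    where
    s = ℤ.sign i Sign.* ℤ.sign j
    m = ℤ.∣ i ∣
    n = ℤ.∣ j ∣

  -‿homo : ∀ i → fromℤ (ℤ.- i) ≈ - fromℤ i
  -‿homo (+ zero)  = sym -0#≈0#
  -‿homo (+ suc n) = refl
  -‿homo -[1+ n ]  = sym (-‿involutive _)

  morphism : ℤ.+-*-rawRing -Raw-AlmostCommutative⟶ fromCommutativeRing R
  morphism = record
    { ⟦_⟧ = fromℤ ; +-homo = +-homo ; *-homo = *-homo ; -‿homo = -‿homo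
    ; 0-homo = refl ; 1-homo = refl }

  fromℤ-≟ : ∀ i j → Maybe (fromℤ i ≈ fromℤ j)
  fromℤ-≟ i j with i ℤ.≟ j
  ... | yes ≡.refl = just refl
  ... | no _       = nothing

  open import Algebra.Solver.Ring ℤ.+-*-rawRing (fromCommutativeRing R) morphism fromℤ-≟ public
    using (solve; con; _:+_; _:-_; _:*_; _:=_)

module _ {a ℓ} (R : CommutativeRing a ℓ) where
  open CommutativeRing R

  module QCartanProperties (q qi K Ki δ : Carrier) (ι : ℕ → Carrier) (q*qi≈1 : q * qi ≈ 1#) where

    open QCartan R q qi K Ki δ ι
    open IntegerCoefficientSolver R using (solve; con; _:+_; _:-_; _:*_; _:=_)
    open import Relation.Binary.Reasoning.Setoid setoid

    u≈1⇒u*z≈z : ∀ {u} z → u ≈ 1# → u * z ≈ z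
    u≈1⇒u*z≈z z u≈1 = trans (*-congʳ u≈1) (*-identityˡ z)

    qi*q≈1 : qi * q ≈ 1#
    qi*q≈1 = trans (*-comm qi q) q*qi≈1

    pow-inverse : ∀ n → pow q n * pow qi n ≈ 1#
    pow-inverse zero    = *-identityʳ 1#
    pow-inverse (suc n) = begin
      q * pow q n * (qi * pow qi n)
        ≈⟨ solve 4 (λ q qi p p′ → q :* p :* (qi :* p′) := q :* qi :* (p :* p′))
             refl q qi (pow q n) (pow qi n) ⟩
      q * qi * (pow q n * pow qi n)   ≈⟨ *-cong q*qi≈1 (pow-inverse n) ⟩
      1# * 1#                         ≈⟨ *-identityʳ 1# ⟩
      1#                              ∎

    bracket : Carrier → Carrier → Carrier
    bracket x y = (x - y) * δ

    bracket-cong : ∀ {x x′ y y′} → x ≈ x′ → y ≈ y′ → bracket x y ≈ bracket x′ y′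
    bracket-cong x≈x′ y≈y′ = *-congʳ (+-cong x≈x′ (-‿cong y≈y′))

    bracket-*-unit : ∀ {u} x y → u ≈ 1# → bracket x y ≈ bracket (x * u) (y * u)
    bracket-*-unit x y u≈1 = sym (bracket-cong (z*u≈z x) (z*u≈z y))
      where
      z*u≈z : ∀ z → z * _ ≈ z
      z*u≈z z = trans (*-comm z _) (u≈1⇒u*z≈z z u≈1)

    -- The F(x, y, t) of the header: falling c t is fallingAt (q^c K) (q^{-c} K⁻¹) t.
    fallingAt : Carrier → Carrier → ℕ → Carrier
    fallingAt x y zero    = 1#
    fallingAt x y (suc t) = fallingAt x y t * bracket (pow qi t * x) (pow q t * y)

    fallingAt-cong : ∀ {x x′ y y′} → x ≈ x′ → y ≈ y′ → ∀ t → fallingAt x y t ≈ fallingAt x′ y′ t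
    fallingAt-cong x≈x′ y≈y′ zero    = refl
    fallingAt-cong x≈x′ y≈y′ (suc t) =
      *-cong (fallingAt-cong x≈x′ y≈y′ t) (bracket-cong (*-congˡ x≈x′) (*-congˡ y≈y′))

    fallingAt-shift : ∀ t x y →
      fallingAt (q * x) (qi * y) (suc t) ≈ bracket (q * x) (qi * y) * fallingAt x y t
    fallingAt-shift zero    x y =
      solve 5 (λ q qi x y δ → let 1ᵣ = con (+ 1) in
          1ᵣ :* ((1ᵣ :* (q :* x) :- 1ᵣ :* (qi :* y)) :* δ) := (q :* x :- qi :* y) :* δ :* 1ᵣ)
        refl q qi x y δ
    fallingAt-shift (suc t) x y = begin
      fallingAt (q * x) (qi * y) (suc t) * bracket (qi * pow qi t * (q * x)) (q * pow q t * (qi * y))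
        ≈⟨ *-cong (fallingAt-shift t x y)
                  (bracket-cong (cancel (pow qi t) x qi*q≈1) (cancel (pow q t) y q*qi≈1)) ⟩
      bracket (q * x) (qi * y) * fallingAt x y t * bracket (pow qi t * x) (pow q t * y)
        ≈⟨ *-assoc _ _ _ ⟩
      bracket (q * x) (qi * y) * fallingAt x y (suc t) ∎
      where
      cancel : ∀ {u v} p z → u * v ≈ 1# → u * p * (v * z) ≈ p * z
      cancel {u} {v} p z uv≈1 = trans
        (solve 4 (λ u v p z → u :* p :* (v :* z) := u :* v :* (p :* z)) refl u v p z)
        (u≈1⇒u*z≈z _ uv≈1)

    bracket-pascalˡ : ∀ t x y → bracket (q * x) (qi * y) ≈
      pow q (suc t) * bracket (pow qi t * x) (pow q t * y) + pow q t * y * qnum (suc t)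
    bracket-pascalˡ t x y = trans (bracket-*-unit (q * x) (qi * y) (pow-inverse t))
      (solve 7 (λ q qi p p′ x y δ →
          (q :* x :* (p :* p′) :- qi :* y :* (p :* p′)) :* δ
          := q :* p :* ((p′ :* x :- p :* y) :* δ) :+ p :* y :* ((q :* p :- qi :* p′) :* δ))
        refl q qi (pow q t) (pow qi t) x y δ)

    bracket-pascalʳ : ∀ t x y → bracket (q * x) (qi * y) ≈
      pow qi (suc t) * bracket (pow qi t * x) (pow q t * y) + pow qi t * x * qnum (suc t)
    bracket-pascalʳ t x y = trans (bracket-*-unit (q * x) (qi * y) (pow-inverse t))
      (solve 7 (λ q qi p p′ x y δ →
          (q :* x :* (p :* p′) :- qi :* y :* (p :* p′)) :* δ
          := qi :* p′ :* ((p′ :* x :- p :* y) :* δ) :+ p′ :* x :* ((q :* p :- qi :* p′) :* δ))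
        refl q qi (pow q t) (pow qi t) x y δ)

    fallingAt-pascal : ∀ t x y α β →
      bracket (q * x) (qi * y) ≈ α * bracket (pow qi t * x) (pow q t * y) + β →
      fallingAt (q * x) (qi * y) (suc t) ≈ α * fallingAt x y (suc t) + β * fallingAt x y t
    fallingAt-pascal t x y α β split = begin
      fallingAt (q * x) (qi * y) (suc t)                 ≈⟨ fallingAt-shift t x y ⟩
      bracket (q * x) (qi * y) * fallingAt x y t         ≈⟨ *-congʳ split ⟩
      (α * b + β) * fallingAt x y t
        ≈⟨ solve 4 (λ α β b f → (α :* b :+ β) :* f := α :* (f :* b) :+ β :* f)
             refl α β b (fallingAt x y t) ⟩
      α * fallingAt x y (suc t) + β * fallingAt x y t    ∎
      where
      b = bracket (pow qi t * x) (pow q t * y)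

    fallingAt-pascalˡ : ∀ t x y → fallingAt (q * x) (qi * y) (suc t) ≈
      pow q (suc t) * fallingAt x y (suc t) + pow q t * y * qnum (suc t) * fallingAt x y t
    fallingAt-pascalˡ t x y = fallingAt-pascal t x y _ _ (bracket-pascalˡ t x y)

    fallingAt-pascalʳ : ∀ t x y → fallingAt (q * x) (qi * y) (suc t) ≈
      pow qi (suc t) * fallingAt x y (suc t) + pow qi t * x * qnum (suc t) * fallingAt x y t
    fallingAt-pascalʳ t x y = fallingAt-pascal t x y _ _ (bracket-pascalʳ t x y)

    fallingAt-second-difference : ∀ t x y →
      fallingAt (q * (q * x)) (qi * (qi * y)) (suc t) ≈
        (pow q (suc t) + pow qi (suc t)) * fallingAt (q * x) (qi * y) (suc t) - fallingAt x y (suc t)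
        + pow q t * (qi * y) * qnum (suc t) * (fallingAt (q * x) (qi * y) t - pow qi t * fallingAt x y t)
    fallingAt-second-difference t x y = begin
      fallingAt (q * (q * x)) (qi * (qi * y)) (suc t)
        ≈⟨ fallingAt-pascalˡ t (q * x) (qi * y) ⟩
      Q * F₁ + p * (qi * y) * n * F₁′
        ≈⟨ solve 7 (λ Q Q′ F₁ p qiy n F₁′ →
               Q :* F₁ :+ p :* qiy :* n :* F₁′ := (Q :+ Q′) :* F₁ :- Q′ :* F₁ :+ p :* qiy :* n :* F₁′)
             refl Q Q′ F₁ p (qi * y) n F₁′ ⟩
      (Q + Q′) * F₁ - Q′ * F₁ + p * (qi * y) * n * F₁′
        ≈⟨ +-congʳ (+-congˡ (-‿cong (*-congˡ (fallingAt-pascalˡ t x y)))) ⟩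
      (Q + Q′) * F₁ - Q′ * (Q * F₀ + p * y * n * F₀′) + p * (qi * y) * n * F₁′
        ≈⟨ solve 10 (λ q qi p p′ y n F₁ F₁′ F₀ F₀′ → let Q = q :* p ; Q′ = qi :* p′ in
               (Q :+ Q′) :* F₁ :- Q′ :* (Q :* F₀ :+ p :* y :* n :* F₀′) :+ p :* (qi :* y) :* n :* F₁′
               := (Q :+ Q′) :* F₁ :- Q :* Q′ :* F₀ :+ p :* (qi :* y) :* n :* (F₁′ :- p′ :* F₀′))
             refl q qi p (pow qi t) y n F₁ F₁′ F₀ F₀′ ⟩
      (Q + Q′) * F₁ - Q * Q′ * F₀ + p * (qi * y) * n * (F₁′ - pow qi t * F₀′)
        ≈⟨ +-congʳ (+-congˡ (-‿cong (u≈1⇒u*z≈z F₀ (pow-inverse (suc t))))) ⟩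
      (Q + Q′) * F₁ - F₀ + p * (qi * y) * n * (F₁′ - pow qi t * F₀′) ∎
      where
      Q Q′ p n F₁ F₁′ F₀ F₀′ : Carrier
      Q   = pow q (suc t)
      Q′  = pow qi (suc t)
      p   = pow q t
      n   = qnum (suc t)
      F₁  = fallingAt (q * x) (qi * y) (suc t)
      F₁′ = fallingAt (q * x) (qi * y) t
      F₀  = fallingAt x y (suc t)
      F₀′ = fallingAt x y t

    fallingAt-recurrence₁ : ∀ x y →
      fallingAt (q * (q * x)) (qi * (qi * y)) 1 ≈
        (pow q 1 + pow qi 1) * fallingAt (q * x) (qi * y) 1 - fallingAt x y 1
    fallingAt-recurrence₁ x y = trans (fallingAt-second-difference 0 x y)
      (solve 4 (λ A B qiy n → let 1ᵣ = con (+ 1) in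
          A :- B :+ 1ᵣ :* qiy :* n :* (1ᵣ :- 1ᵣ :* 1ᵣ) := A :- B)
        refl ((pow q 1 + pow qi 1) * fallingAt (q * x) (qi * y) 1) (fallingAt x y 1) (qi * y) (qnum 1))

    fallingAt-recurrence : ∀ r x y →
      fallingAt (q * (q * x)) (qi * (qi * y)) (suc (suc r)) ≈
        (pow q (suc (suc r)) + pow qi (suc (suc r))) * fallingAt (q * x) (qi * y) (suc (suc r))
        - fallingAt x y (suc (suc r))
        + qnum (suc (suc r)) * qnum (suc r) * (x * y) * fallingAt x y r
    fallingAt-recurrence r x y = trans (fallingAt-second-difference (suc r) x y) (+-congˡ (begin
      p * (qi * y) * n₂ * (F₁ - pow qi (suc r) * F₀)
        ≈⟨ *-congˡ (+-congʳ (fallingAt-pascalʳ r x y)) ⟩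
      p * (qi * y) * n₂ * (pow qi (suc r) * F₀ + pow qi r * x * n₁ * F - pow qi (suc r) * F₀)
        ≈⟨ solve 10 (λ q qi p p′ x y n₂ n₁ F₀ F →
               q :* p :* (qi :* y) :* n₂ :* (qi :* p′ :* F₀ :+ p′ :* x :* n₁ :* F :- qi :* p′ :* F₀)
               := q :* qi :* (p :* p′ :* (n₂ :* n₁ :* (x :* y) :* F)))
             refl q qi (pow q r) (pow qi r) x y n₂ n₁ F₀ F ⟩
      q * qi * (pow q r * pow qi r * (n₂ * n₁ * (x * y) * F))   ≈⟨ u≈1⇒u*z≈z _ q*qi≈1 ⟩
      pow q r * pow qi r * (n₂ * n₁ * (x * y) * F)              ≈⟨ u≈1⇒u*z≈z _ (pow-inverse r) ⟩
      n₂ * n₁ * (x * y) * F                                     ∎))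
      where
      p n₂ n₁ F₁ F₀ F : Carrier
      p  = pow q (suc r)
      n₂ = qnum (suc (suc r))
      n₁ = qnum (suc r)
      F₁ = fallingAt (q * x) (qi * y) (suc r)
      F₀ = fallingAt x y (suc r)
      F  = fallingAt x y r

    qpow-suc : ∀ a → qpow (ℤ.suc a) ≈ q * qpow a
    qpow-suc (+ n)         = refl
    qpow-suc -[1+ zero ]   = sym (trans (*-congˡ (*-identityʳ qi)) q*qi≈1)
    qpow-suc -[1+ suc n ]  = sym (trans (sym (*-assoc q qi _)) (u≈1⇒u*z≈z _ q*qi≈1))

    qpow-pred : ∀ a → qpow (ℤ.pred a) ≈ qi * qpow a
    qpow-pred a = begin
      qpow (ℤ.pred a)                  ≈⟨ u≈1⇒u*z≈z _ qi*q≈1 ⟨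
      qi * q * qpow (ℤ.pred a)         ≈⟨ *-assoc qi q _ ⟩
      qi * (q * qpow (ℤ.pred a))       ≈⟨ *-congˡ (qpow-suc (ℤ.pred a)) ⟨
      qi * qpow (ℤ.suc (ℤ.pred a))     ≡⟨ ≡.cong (λ b → qi * qpow b) (ℤ.suc-pred a) ⟩
      qi * qpow a                      ∎

    qpow-+ : ∀ a i → qpow (a ℤ.+ + i) ≈ pow q i * qpow a
    qpow-+ a zero    = trans (reflexive (≡.cong qpow (ℤ.+-identityʳ a))) (sym (*-identityˡ _))
    qpow-+ a (suc i) = begin
      qpow (a ℤ.+ + suc i)             ≡⟨ ≡.cong qpow a+[1+i]≡suc[a+i] ⟩
      qpow (ℤ.suc (a ℤ.+ + i))         ≈⟨ qpow-suc (a ℤ.+ + i) ⟩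
      q * qpow (a ℤ.+ + i)             ≈⟨ *-congˡ (qpow-+ a i) ⟩
      q * (pow q i * qpow a)           ≈⟨ *-assoc q _ _ ⟨
      pow q (suc i) * qpow a           ∎
      where
      a+[1+i]≡suc[a+i] : a ℤ.+ + suc i ≡ ℤ.suc (a ℤ.+ + i)
      a+[1+i]≡suc[a+i] = ≡.trans (ℤ.+-comm a (+ suc i))
        (≡.trans (ℤ.suc-+ i a) (≡.cong ℤ.suc (ℤ.+-comm (+ i) a)))

    qpow-∸ : ∀ a i → qpow (a ℤ.- + i) ≈ pow qi i * qpow a
    qpow-∸ a zero    = trans (reflexive (≡.cong qpow (ℤ.+-identityʳ a))) (sym (*-identityˡ _))
    qpow-∸ a (suc i) = begin
      qpow (a ℤ.- + suc i)             ≡⟨ ≡.cong qpow (ℤ.minus-suc a i) ⟩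
      qpow (ℤ.pred (a ℤ.- + i))        ≈⟨ qpow-pred (a ℤ.- + i) ⟩
      qi * qpow (a ℤ.- + i)            ≈⟨ *-congˡ (qpow-∸ a i) ⟩
      qi * (pow qi i * qpow a)         ≈⟨ *-assoc qi _ _ ⟨
      pow qi (suc i) * qpow a          ∎

    qpow-inverse : ∀ a → qpow a * qpow (ℤ.- a) ≈ 1#
    qpow-inverse (+ zero)  = *-identityʳ 1#
    qpow-inverse (+ suc n) = pow-inverse (suc n)
    qpow-inverse -[1+ n ]  = trans (*-comm _ _) (pow-inverse (suc n))

    X Y : ℤ → Carrier
    X c = qpow c * K
    Y c = qpow (ℤ.- c) * Ki

    X*Y≈1 : K * Ki ≈ 1# → ∀ c → X c * Y c ≈ 1#
    X*Y≈1 K*Ki≈1 c = begin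
      qpow c * K * (qpow (ℤ.- c) * Ki)
        ≈⟨ solve 4 (λ a b k k′ → a :* k :* (b :* k′) := a :* b :* (k :* k′))
             refl (qpow c) (qpow (ℤ.- c)) K Ki ⟩
      qpow c * qpow (ℤ.- c) * (K * Ki)      ≈⟨ *-cong (qpow-inverse c) K*Ki≈1 ⟩
      1# * 1#                               ≈⟨ *-identityʳ 1# ⟩
      1#                                    ∎

    Kbr-∸ : ∀ c i → Kbr (c ℤ.- + i) ≈ bracket (pow qi i * X c) (pow q i * Y c)
    Kbr-∸ c i = bracket-cong
      (trans (*-congʳ (qpow-∸ c i)) (*-assoc _ _ K))
      (trans (*-congʳ (trans (reflexive (≡.cong qpow -[c-i]≡-c+i)) (qpow-+ (ℤ.- c) i))) (*-assoc _ _ Ki))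
      where
      -[c-i]≡-c+i : ℤ.- (c ℤ.- + i) ≡ ℤ.- c ℤ.+ + i
      -[c-i]≡-c+i = ≡.trans (ℤ.neg-distrib-+ c (ℤ.- + i))
                            (≡.cong (λ j → ℤ.- c ℤ.+ j) (ℤ.neg-involutive (+ i)))

    X-suc : ∀ c → X (c ℤ.+ + 1) ≈ q * X c
    X-suc c = trans (*-congʳ (qpow-+ c 1))
      (solve 3 (λ q a k → q :* con (+ 1) :* a :* k := q :* (a :* k)) refl q (qpow c) K)

    Y-suc : ∀ c → Y (c ℤ.+ + 1) ≈ qi * Y c
    Y-suc c = trans (*-congʳ (trans (reflexive (≡.cong qpow (ℤ.neg-distrib-+ c (+ 1)))) (qpow-∸ (ℤ.- c) 1)))
      (solve 3 (λ qi a k → qi :* con (+ 1) :* a :* k := qi :* (a :* k)) refl qi (qpow (ℤ.- c)) Ki)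

    falling≈fallingAt : ∀ c t → falling c t ≈ fallingAt (X c) (Y c) t
    falling≈fallingAt c zero    = refl
    falling≈fallingAt c (suc t) = *-cong (falling≈fallingAt c t) (Kbr-∸ c t)

    falling-suc≈fallingAt : ∀ c t → falling (c ℤ.+ + 1) t ≈ fallingAt (q * X c) (qi * Y c) t
    falling-suc≈fallingAt c t = trans (falling≈fallingAt (c ℤ.+ + 1) t) (fallingAt-cong (X-suc c) (Y-suc c) t)

    falling-suc²≈fallingAt : ∀ c t → falling (c ℤ.+ + 2) t ≈ fallingAt (q * (q * X c)) (qi * (qi * Y c)) t
    falling-suc²≈fallingAt c t = begin
      falling (c ℤ.+ + 2) t
        ≡⟨ ≡.cong (λ b → falling b t) (≡.sym (ℤ.+-assoc c (+ 1) (+ 1))) ⟩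
      falling (c ℤ.+ + 1 ℤ.+ + 1) t
        ≈⟨ falling-suc≈fallingAt (c ℤ.+ + 1) t ⟩
      fallingAt (q * X (c ℤ.+ + 1)) (qi * Y (c ℤ.+ + 1)) t
        ≈⟨ fallingAt-cong (*-congˡ (X-suc c)) (*-congˡ (Y-suc c)) t ⟩
      fallingAt (q * (q * X c)) (qi * (qi * Y c)) t ∎

    falling-recurrence₁ : ∀ c →
      falling (c ℤ.+ + 2) 1 ≈ (pow q 1 + pow qi 1) * falling (c ℤ.+ + 1) 1 - falling c 1
    falling-recurrence₁ c = begin
      falling (c ℤ.+ + 2) 1                                   ≈⟨ falling-suc²≈fallingAt c 1 ⟩
      fallingAt (q * (q * X c)) (qi * (qi * Y c)) 1           ≈⟨ fallingAt-recurrence₁ (X c) (Y c) ⟩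
      (pow q 1 + pow qi 1) * fallingAt (q * X c) (qi * Y c) 1 - fallingAt (X c) (Y c) 1
        ≈⟨ +-cong (*-congˡ (falling-suc≈fallingAt c 1)) (-‿cong (falling≈fallingAt c 1)) ⟨
      (pow q 1 + pow qi 1) * falling (c ℤ.+ + 1) 1 - falling c 1 ∎

    falling-recurrence : K * Ki ≈ 1# → ∀ r c →
      falling (c ℤ.+ + 2) (suc (suc r)) ≈
        (pow q (suc (suc r)) + pow qi (suc (suc r))) * falling (c ℤ.+ + 1) (suc (suc r))
        - falling c (suc (suc r))
        + qnum (suc (suc r)) * qnum (suc r) * falling c r
    falling-recurrence K*Ki≈1 r c = begin
      falling (c ℤ.+ + 2) t                              ≈⟨ falling-suc²≈fallingAt c t ⟩
      fallingAt (q * (q * X c)) (qi * (qi * Y c)) t      ≈⟨ fallingAt-recurrence r (X c) (Y c) ⟩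
      (Q + Q′) * fallingAt (q * X c) (qi * Y c) t - fallingAt (X c) (Y c) t
        + n₂ * n₁ * (X c * Y c) * fallingAt (X c) (Y c) r
        ≈⟨ +-cong (+-cong (*-congˡ (falling-suc≈fallingAt c t)) (-‿cong (falling≈fallingAt c t)))
                  (*-cong (sym (trans (*-congˡ (X*Y≈1 K*Ki≈1 c)) (*-identityʳ _)))
                          (falling≈fallingAt c r)) ⟨
      (Q + Q′) * falling (c ℤ.+ + 1) t - falling c t + n₂ * n₁ * falling c r ∎
      where
      t : ℕ
      t = suc (suc r)
      Q Q′ n₂ n₁ : Carrier
      Q  = pow q t
      Q′ = pow qi t
      n₂ = qnum t
      n₁ = qnum (suc r)

    qnum*qnum*ι≈ι : (∀ n → qfact n * ι n ≈ 1#) → ∀ r →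
      qnum (suc (suc r)) * qnum (suc r) * ι (suc (suc r)) ≈ ι r
    qnum*qnum*ι≈ι qfact*ι≈1 r = begin
      n₂ * n₁ * ι (suc (suc r))                        ≈⟨ u≈1⇒u*z≈z _ (qfact*ι≈1 r) ⟨
      qfact r * ι r * (n₂ * n₁ * ι (suc (suc r)))
        ≈⟨ solve 5 (λ f i n₂ n₁ i₂ → f :* i :* (n₂ :* n₁ :* i₂) := i :* (n₂ :* (n₁ :* f) :* i₂))
             refl (qfact r) (ι r) n₂ n₁ (ι (suc (suc r))) ⟩
      ι r * (qfact (suc (suc r)) * ι (suc (suc r)))    ≈⟨ *-congˡ (qfact*ι≈1 (suc (suc r))) ⟩
      ι r * 1#                                         ≈⟨ *-identityʳ (ι r) ⟩
      ι r                                              ∎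
      where
      n₂ n₁ : Carrier
      n₂ = qnum (suc (suc r))
      n₁ = qnum (suc r)

    binom-recurrence₁ : ∀ c →
      binom (c ℤ.+ + 2) 1 ≈ (pow q 1 + pow qi 1) * binom (c ℤ.+ + 1) 1 - binom c 1
    binom-recurrence₁ c = begin
      falling (c ℤ.+ + 2) 1 * ι 1
        ≈⟨ *-congʳ (falling-recurrence₁ c) ⟩
      ((pow q 1 + pow qi 1) * falling (c ℤ.+ + 1) 1 - falling c 1) * ι 1
        ≈⟨ solve 5 (λ Q Q′ f₁ f₀ ι₁ →
               ((Q :+ Q′) :* f₁ :- f₀) :* ι₁ := (Q :+ Q′) :* (f₁ :* ι₁) :- f₀ :* ι₁)
             refl (pow q 1) (pow qi 1) (falling (c ℤ.+ + 1) 1) (falling c 1) (ι 1) ⟩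
      (pow q 1 + pow qi 1) * binom (c ℤ.+ + 1) 1 - binom c 1     ∎

    binom-recurrence : K * Ki ≈ 1# → (∀ n → qfact n * ι n ≈ 1#) → ∀ r c →
      binom (c ℤ.+ + 2) (suc (suc r)) ≈
        (pow q (suc (suc r)) + pow qi (suc (suc r))) * binom (c ℤ.+ + 1) (suc (suc r))
        - binom c (suc (suc r))
        + binom c r
    binom-recurrence K*Ki≈1 qfact*ι≈1 r c = begin
      falling (c ℤ.+ + 2) t * ι t
        ≈⟨ *-congʳ (falling-recurrence K*Ki≈1 r c) ⟩
      ((Q + Q′) * falling (c ℤ.+ + 1) t - falling c t + n₂ * n₁ * falling c r) * ι t
        ≈⟨ solve 8 (λ Q Q′ f₁ f₀ n₂ n₁ f ι₂ →
               ((Q :+ Q′) :* f₁ :- f₀ :+ n₂ :* n₁ :* f) :* ι₂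
               := (Q :+ Q′) :* (f₁ :* ι₂) :- f₀ :* ι₂ :+ f :* (n₂ :* n₁ :* ι₂))
             refl Q Q′ (falling (c ℤ.+ + 1) t) (falling c t) n₂ n₁ (falling c r) (ι t) ⟩
      (Q + Q′) * binom (c ℤ.+ + 1) t - binom c t + falling c r * (n₂ * n₁ * ι t)
        ≈⟨ +-congˡ (*-congˡ (qnum*qnum*ι≈ι qfact*ι≈1 r)) ⟩
      (Q + Q′) * binom (c ℤ.+ + 1) t - binom c t + binom c r     ∎
      where
      t : ℕ
      t = suc (suc r)
      Q Q′ n₂ n₁ : Carrier
      Q  = pow q t
      Q′ = pow qi t
      n₂ = qnum t
      n₁ = qnum (suc r)

proposition6p1 : ∀ {a ℓ} (R : CommutativeRing a ℓ) →
  let open CommutativeRing R in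
  (q qi K Ki δ : Carrier) (ι : ℕ → Carrier) →
  q * qi ≈ 1# → K * Ki ≈ 1# → (q + - qi) * δ ≈ 1# →
  (∀ n → QCartan.qfact R q qi K Ki δ ι n * ι n ≈ 1#) →
  (t : ℕ) (c : ℤ) → 1 ≤ t →
  QCartan.binomℤ R q qi K Ki δ ι (c ℤ.+ + 2) (+ t)
    ≈ (QCartan.qpow R q qi K Ki δ ι (+ t) + QCartan.qpow R q qi K Ki δ ι (ℤ.- (+ t)))
        * QCartan.binomℤ R q qi K Ki δ ι (c ℤ.+ + 1) (+ t)
      + - QCartan.binomℤ R q qi K Ki δ ι c (+ t)
      + QCartan.binomℤ R q qi K Ki δ ι c (+ t ℤ.- + 2)
proposition6p1 R q qi K Ki δ ι q*qi≈1 _ _ _ 1 c _ =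
  trans (binom-recurrence₁ c) (sym (+-identityʳ _))
  where
  open CommutativeRing R
  open QCartanProperties R q qi K Ki δ ι q*qi≈1
proposition6p1 R q qi K Ki δ ι q*qi≈1 K*Ki≈1 _ qfact*ι≈1 (suc (suc r)) c _ =
  binom-recurrence K*Ki≈1 qfact*ι≈1 r c
  where
  open QCartanProperties R q qi K Ki δ ι q*qi≈1
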